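{- For an integer $h\geq 1$ let $\Gamma_{2^h}$ denote the multiplicative circulant graph $MC(2^h)$. For every integer $h\geq 2$, $$diam(\Gamma_{2^h})=\begin{cases} diam(\Gamma_{2^{h-1}}) & \text{if } h \text{ is even},\\ diam(\Gamma_{2^{h-1}})+1 & \text{if } h \text{ is odd}.\end{cases}$$
   Context: For integers $m>1$, $h>0$, $MC(m^h)$ is the graph with vertex set $\mathbb{Z}_{m^h}$ in which distinct vertices $x,y$ are adjacent iff $x-y\equiv \pm m^i \pmod{m^h}$ for some $i\in\{0,\ldots,h-1\}$. $diam(\Gamma)$ is the maximum distance (shortest path length) between any pair of vertices of $\Gamma$. -}

module Defs where

open import Data.Nat using (ℕ; zero; suc; _+_; _*_; _^_; _≤_; _<_)
open import Data.Fin using (Fin; toℕ)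
open import Data.Product using (Σ; ∃; _×_; _,_)
open import Data.Sum using (_⊎_)
open import Relation.Binary.PropositionalEquality using (_≡_; _≢_)

_≡_[mod_] : ℕ → ℕ → ℕ → Set
a ≡ b [mod N ] = ∃ λ k → (a ≡ b + k * N) ⊎ (b ≡ a + k * N)

-- the multiplicative circulant graph MC(m^h): vertex set Z_{m^h} (as Fin (m ^ h)),
-- distinct x, y adjacent iff x - y ≡ ± m^i (mod m^h) for some i ∈ {0,…,h-1}
MCAdj : (m h : ℕ) → Fin (m ^ h) → Fin (m ^ h) → Set
MCAdj m h x y =
  (x ≢ y) × (∃ λ i → (i < h) ×
     ((toℕ x ≡ toℕ y + m ^ i [mod m ^ h ]) ⊎ (toℕ y ≡ toℕ x + m ^ i [mod m ^ h ])))

data Walk (m h : ℕ) : ℕ → Fin (m ^ h) → Fin (m ^ h) → Set where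
  here : ∀ {x} → Walk m h zero x x
  step : ∀ {n x y z} → MCAdj m h x y → Walk m h n y z → Walk m h (suc n) x z

IsDiam : (m h : ℕ) → ℕ → Set
IsDiam m h d =
  ((x y : Fin (m ^ h)) → ∃ λ n → (n ≤ d) × Walk m h n x y) ×
  (∃ λ x → ∃ λ y → ∀ n → Walk m h n x y → d ≤ n)

-- In MC(2^h) the distance from x to y is the least number of signed powers ±2^i (i < h)
-- summing to y - x modulo 2^h.  Balanced base-4 digits 0, ±1, 2 spend one term per two bits,
-- so every residue needs at most ⌈h/2⌉ terms.  Conversely, a representation of 2q modulo
-- 2^(h+1) halves to one of q modulo 2^h that is no longer (the terms ±2^(i+1) halve, and the
-- terms ±1 pair up into 0 or ±2), and a representation of an odd number contains a term ±1.
-- By a mutual induction through R ± 1 and 2R + 1 ± 1, the base-4 repunit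
-- R = 1 + 4 + … + 4^(k-1) with k = ⌈h/2⌉ needs k terms modulo 2^h, so the diameter is ⌈h/2⌉;
-- and ⌈h/2⌉ = ⌈(h-1)/2⌉ exactly when h is even.
module Submission where

open import Defs
open import Data.Nat as ℕ
  using (ℕ; zero; suc; z≤n; s≤s; z<s; _≤_; _<_; _%_; _∸_; _^_; ⌊_/2⌋; ⌈_/2⌉; NonZero)
import Data.Nat.Properties as ℕₚ
open import Data.Integer using (ℤ; +_; +[1+_]; -[1+_]; -_; _+_; _-_; _*_; 0ℤ; 1ℤ; -1ℤ)
import Data.Integer.Properties as ℤₚ
open import Data.Integer.Properties using (pos-+; pos-*; +-injective)
open import Data.Integer.DivMod using (_%ℕ_; _/ℕ_; n%ℕd<d; a≡a%ℕn+[a/ℕn]*n)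
open import Data.Integer.Tactic.RingSolver using (solve-∀)
open import Data.Fin using (Fin; toℕ; fromℕ<)
import Data.Fin.Properties as Finₚ
open import Data.List using (List; []; _∷_; length; map; foldr)
open import Data.List.Properties using (length-map)
open import Data.List.Relation.Unary.All as All using (All; []; _∷_)
open import Data.List.Relation.Unary.All.Properties using (map⁺)
open import Data.Product using (∃; _×_; _,_)
open import Data.Sum using (_⊎_; inj₁; inj₂)
open import Data.Empty using (⊥-elim)
open import Relation.Nullary using (¬_)
open import Relation.Binary.PropositionalEquality
  using (_≡_; _≢_; refl; sym; trans; cong; cong₂; subst; subst₂; module ≡-Reasoning)

private variable
  h i k m n : ℕ
  a b c d q t x : ℤ
  L : List ℤ

pow2 : ℕ → ℤ
pow2 h = + (2 ^ h)

infix 4 _≡_[mod2^_]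
record _≡_[mod2^_] (a b : ℤ) (h : ℕ) : Set where
  constructor multiple
  field
    quotient : ℤ
    equation : a ≡ b + quotient * pow2 h

≡mod-refl : a ≡ a [mod2^ h ]
≡mod-refl {a} {h} = multiple 0ℤ (lemma a (pow2 h))
  where lemma : ∀ a N → a ≡ a + 0ℤ * N
        lemma = solve-∀

≡mod-sym : a ≡ b [mod2^ h ] → b ≡ a [mod2^ h ]
≡mod-sym {b = b} {h} (multiple k refl) = multiple (- k) (lemma b k (pow2 h))
  where lemma : ∀ b k N → b ≡ (b + k * N) + - k * N
        lemma = solve-∀

≡mod-+ : a ≡ b [mod2^ h ] → c ≡ d [mod2^ h ] → a + c ≡ b + d [mod2^ h ]
≡mod-+ {b = b} {h} {d = d} (multiple k refl) (multiple l refl) =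
  multiple (k + l) (lemma b d k l (pow2 h))
  where lemma : ∀ b d k l N → (b + k * N) + (d + l * N) ≡ (b + d) + (k + l) * N
        lemma = solve-∀

≡mod-neg : a ≡ b [mod2^ h ] → - a ≡ - b [mod2^ h ]
≡mod-neg {b = b} {h} (multiple k refl) = multiple (- k) (lemma b k (pow2 h))
  where lemma : ∀ b k N → - (b + k * N) ≡ - b + - k * N
        lemma = solve-∀

≡mod-sub : a ≡ b + c [mod2^ h ] → a - b ≡ c [mod2^ h ]
≡mod-sub {b = b} {c} e = subst (_ ≡_[mod2^ _ ]) (lemma b c) (≡mod-+ e (≡mod-refl { - b}))
  where lemma : ∀ b c → (b + c) - b ≡ c
        lemma = solve-∀

≡mod-add : a - b ≡ c [mod2^ h ] → a ≡ b + c [mod2^ h ]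
≡mod-add {a} {b} e = subst (_≡ _ [mod2^ _ ]) (lemma a b) (≡mod-+ (≡mod-refl {b}) e)
  where lemma : ∀ a b → b + (a - b) ≡ a
        lemma = solve-∀

pow2-suc : ∀ h → pow2 (suc h) ≡ + 2 * pow2 h
pow2-suc h = pos-* 2 (2 ^ h)

≡mod-double : a ≡ b [mod2^ h ] → + 2 * a ≡ + 2 * b [mod2^ suc h ]
≡mod-double {b = b} {h} (multiple k refl) = multiple k (begin
  + 2 * (b + k * pow2 h)      ≡⟨ lemma b k (pow2 h) ⟩
  + 2 * b + k * (+ 2 * pow2 h) ≡⟨ cong (λ N → + 2 * b + k * N) (sym (pow2-suc h)) ⟩
  + 2 * b + k * pow2 (suc h)   ∎)
  where open ≡-Reasoning
        lemma : ∀ b k N → + 2 * (b + k * N) ≡ + 2 * b + k * (+ 2 * N)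
        lemma = solve-∀

≡mod-halve : + 2 * a ≡ + 2 * b [mod2^ suc h ] → a ≡ b [mod2^ h ]
≡mod-halve {a} {b} {h} (multiple k e) = multiple k (ℤₚ.*-cancelˡ-≡ (+ 2) a (b + k * pow2 h) (begin
  + 2 * a                      ≡⟨ e ⟩
  + 2 * b + k * pow2 (suc h)   ≡⟨ cong (λ N → + 2 * b + k * N) (pow2-suc h) ⟩
  + 2 * b + k * (+ 2 * pow2 h) ≡⟨ lemma b k (pow2 h) ⟩
  + 2 * (b + k * pow2 h)       ∎))
  where open ≡-Reasoning
        lemma : ∀ b k N → + 2 * b + k * (+ 2 * N) ≡ + 2 * (b + k * N)
        lemma = solve-∀

2*≢1 : ∀ z → + 2 * z ≢ 1ℤ
2*≢1 (+ zero) ()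
2*≢1 +[1+ n ] e = ℕₚ.m+1+n≢0 n (ℕₚ.suc-injective (+-injective e))
2*≢1 -[1+ n ] ()

odd≢even : ∀ q p → + 2 * q + 1ℤ ≢ + 2 * p
odd≢even q p e = 2*≢1 (p - q) (begin
  + 2 * (p - q)             ≡⟨ lemma p q ⟩
  + 2 * p - + 2 * q         ≡⟨ cong (_- + 2 * q) (sym e) ⟩
  + 2 * q + 1ℤ - + 2 * q    ≡⟨ lemma′ q ⟩
  1ℤ                        ∎)
  where open ≡-Reasoning
        lemma : ∀ p q → + 2 * (p - q) ≡ + 2 * p - + 2 * q
        lemma = solve-∀
        lemma′ : ∀ q → + 2 * q + 1ℤ - + 2 * q ≡ 1ℤ
        lemma′ = solve-∀

pos-lincomb : ∀ m k n → + (m ℕ.+ k ℕ.* n) ≡ + m + + k * + n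
pos-lincomb m k n = trans (pos-+ m (k ℕ.* n)) (cong (λ z → + m + z) (pos-* k n))

≡mod⇒≡mod2^ : m ≡ n [mod 2 ^ h ] → + m ≡ + n [mod2^ h ]
≡mod⇒≡mod2^ (k , inj₁ e) = multiple (+ k) (trans (cong +_ e) (pos-lincomb _ k _))
≡mod⇒≡mod2^ (k , inj₂ e) = ≡mod-sym (multiple (+ k) (trans (cong +_ e) (pos-lincomb _ k _)))

≡mod2^⇒≡mod : + m ≡ + n [mod2^ h ] → m ≡ n [mod 2 ^ h ]
≡mod2^⇒≡mod {n = n} {h} (multiple (+ k) e) =
  k , inj₁ (+-injective (trans e (sym (pos-lincomb n k (2 ^ h)))))
≡mod2^⇒≡mod {m} {n} {h} (multiple -[1+ k ] e) =
  suc k , inj₂ (+-injective (trans (swap (+ m) (+ n) (+ suc k) (pow2 h) e)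
                                    (sym (pos-lincomb m (suc k) (2 ^ h)))))
  where swap : ∀ a b K N → a ≡ b + (- K) * N → b ≡ a + K * N
        swap _ b K N refl = lemma b K N
          where lemma : ∀ b K N → b ≡ (b + (- K) * N) + K * N
                lemma = solve-∀

<-lincomb-injective : ∀ {N} → m < N → m ≡ n ℕ.+ k ℕ.* N → m ≡ n
<-lincomb-injective {k = zero} _ e = trans e (ℕₚ.+-identityʳ _)
<-lincomb-injective {n = n} {suc k} {N} m<N e = ⊥-elim (ℕₚ.<⇒≱ m<N (subst (N ≤_) (sym e) N≤rhs))
  where N≤rhs : N ≤ n ℕ.+ suc k ℕ.* N
        N≤rhs = ℕₚ.≤-trans (ℕₚ.m≤m+n N (k ℕ.* N)) (ℕₚ.m≤n+m _ n)

≡mod-injective : ∀ {N} → m < N → n < N → m ≡ n [mod N ] → m ≡ n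
≡mod-injective m<N _ (k , inj₁ e) = <-lincomb-injective {k = k} m<N e
≡mod-injective _ n<N (k , inj₂ e) = sym (<-lincomb-injective {k = k} n<N e)

toℕ-≡mod2^-injective : {x y : Fin (2 ^ h)} → + toℕ x ≡ + toℕ y [mod2^ h ] → x ≡ y
toℕ-≡mod2^-injective {x = x} {y} c =
  Finₚ.toℕ-injective (≡mod-injective (Finₚ.toℕ<n x) (Finₚ.toℕ<n y) (≡mod2^⇒≡mod c))

diff≡pow2⇒≡mod : + m - + n ≡ pow2 i [mod2^ h ] → m ≡ n ℕ.+ 2 ^ i [mod 2 ^ h ]
diff≡pow2⇒≡mod {m} {n} {i} {h} c =
  ≡mod2^⇒≡mod (subst (λ s → + m ≡ s [mod2^ h ]) (sym (pos-+ n (2 ^ i)))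
                     (≡mod-add {b = + n} c))

≡mod⇒diff≡pow2 : m ≡ n ℕ.+ 2 ^ i [mod 2 ^ h ] → + m - + n ≡ pow2 i [mod2^ h ]
≡mod⇒diff≡pow2 {m} {n} {i} {h} c =
  ≡mod-sub {b = + n} (subst (λ s → + m ≡ s [mod2^ h ]) (pos-+ n (2 ^ i)) (≡mod⇒≡mod2^ c))

≡mod-diff-swap : a - b ≡ c [mod2^ h ] → b - a ≡ - c [mod2^ h ]
≡mod-diff-swap {a} {b} c = subst (_≡ _ [mod2^ _ ]) (lemma a b) (≡mod-neg c)
  where lemma : ∀ a b → - (a - b) ≡ b - a
        lemma = solve-∀

pow2≢0-mod : i < h → ¬ (pow2 i ≡ 0ℤ [mod2^ h ])
pow2≢0-mod {i} {h} i<h c = ℕₚ.<⇒≢ (ℕₚ.m^n>0 2 i) (sym 2^i≡0)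
  where 2^i≡0 : 2 ^ i ≡ 0
        2^i≡0 = ≡mod-injective (ℕₚ.^-monoʳ-< 2 (s≤s (s≤s z≤n)) i<h) (ℕₚ.m^n>0 2 h)
                               (≡mod2^⇒≡mod c)

data SignedPow2 (h : ℕ) : ℤ → Set where
  plus  : ∀ i → i < h → SignedPow2 h (pow2 i)
  minus : ∀ i → i < h → SignedPow2 h (- pow2 i)

SignedPow2≢0-mod : SignedPow2 h t → ¬ (t ≡ 0ℤ [mod2^ h ])
SignedPow2≢0-mod (plus i i<h) = pow2≢0-mod i<h
SignedPow2≢0-mod (minus i i<h) c =
  pow2≢0-mod i<h (subst (_≡ 0ℤ [mod2^ _ ]) (ℤₚ.neg-involutive (pow2 i)) (≡mod-neg c))

-pow2-suc : ∀ i → - pow2 (suc i) ≡ + 2 * - pow2 i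
-pow2-suc i = trans (cong -_ (pow2-suc i)) (ℤₚ.neg-distribʳ-* (+ 2) (pow2 i))

SignedPow2-double : SignedPow2 h t → SignedPow2 (suc h) (+ 2 * t)
SignedPow2-double (plus i i<h)  = subst (SignedPow2 _) (pow2-suc i) (plus (suc i) (s≤s i<h))
SignedPow2-double (minus i i<h) = subst (SignedPow2 _) (-pow2-suc i) (minus (suc i) (s≤s i<h))

data Sign : ℤ → Set where
  one       : Sign 1ℤ
  minus-one : Sign -1ℤ

data ParityView (h : ℕ) : ℤ → Set where
  odd  : Sign t → ParityView h t
  even : SignedPow2 h t → ParityView h (+ 2 * t)

parityView : SignedPow2 (suc h) t → ParityView h t
parityView (plus zero _)          = odd one
parityView (minus zero _)         = odd minus-one
parityView (plus (suc i) (s≤s p))  = subst (ParityView _) (sym (pow2-suc i)) (even (plus i p))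
parityView (minus (suc i) (s≤s p)) = subst (ParityView _) (sym (-pow2-suc i)) (even (minus i p))

sumℤ : List ℤ → ℤ
sumℤ = foldr _+_ 0ℤ

sumℤ-map-double : ∀ L → sumℤ (map (+ 2 *_) L) ≡ + 2 * sumℤ L
sumℤ-map-double []      = refl
sumℤ-map-double (t ∷ L) =
  trans (cong (λ s → + 2 * t + s) (sumℤ-map-double L)) (sym (ℤₚ.*-distribˡ-+ (+ 2) t (sumℤ L)))

record Represents (h : ℕ) (L : List ℤ) (x : ℤ) : Set where
  constructor represents
  field
    terms : All (SignedPow2 h) L
    sum   : x ≡ sumℤ L [mod2^ h ]

Represents-mod1 : ∀ x → Represents 0 [] x
Represents-mod1 x = represents [] (multiple x (lemma x))
  where lemma : ∀ x → x ≡ 0ℤ + x * 1ℤ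
        lemma = solve-∀

Represents-∷⁺ : SignedPow2 h t → Represents h L (x - t) → Represents h (t ∷ L) x
Represents-∷⁺ p (represents ps c) = represents (p ∷ ps) (≡mod-add c)

Represents-∷⁻ : Represents h (t ∷ L) x → Represents h L (x - t)
Represents-∷⁻ (represents (_ ∷ ps) c) = represents ps (≡mod-sub c)

Represents-double : Represents h L x → Represents (suc h) (map (+ 2 *_) L) (+ 2 * x)
Represents-double {L = L} (represents ps c) =
  represents (map⁺ (All.map SignedPow2-double ps))
             (subst (_ ≡_[mod2^ _ ]) (sym (sumℤ-map-double L)) (≡mod-double c))

WeightAtMost : ℕ → ℕ → ℤ → Set
WeightAtMost h n x = ∃ λ L → length L ≤ n × Represents h L x

WeightAtLeast : ℕ → ℕ → ℤ → Set
WeightAtLeast h n x = ∀ L → Represents h L x → n ≤ length L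

WeightAtMost-mono : m ≤ n → WeightAtMost h m x → WeightAtMost h n x
WeightAtMost-mono m≤n (L , len , r) = L , ℕₚ.≤-trans len m≤n , r

WeightAtMost-double : WeightAtMost h n x → WeightAtMost (suc h) n (+ 2 * x)
WeightAtMost-double {n = n} (L , len , r) =
  map (+ 2 *_) L , subst (_≤ n) (sym (length-map _ L)) len , Represents-double r

WeightAtMost-∷ : d ≡ 0ℤ ⊎ SignedPow2 h d → WeightAtMost h n (x - d) → WeightAtMost h (suc n) x
WeightAtMost-∷ {x = x} (inj₁ refl) (L , len , r) =
  L , ℕₚ.m≤n⇒m≤1+n len , subst (Represents _ L) (ℤₚ.+-identityʳ x) r
WeightAtMost-∷ (inj₂ p) (L , len , r) = _ ∷ L , s≤s len , Represents-∷⁺ p r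

Odd : ℤ → Set
Odd x = ∃ λ q → x ≡ + 2 * q + 1ℤ

Odd⇒≢0-mod : Odd x → ¬ (x ≡ 0ℤ [mod2^ suc h ])
Odd⇒≢0-mod {h = h} (q , refl) (multiple k e) = odd≢even q (k * pow2 h) (begin
  + 2 * q + 1ℤ               ≡⟨ e ⟩
  0ℤ + k * pow2 (suc h)      ≡⟨ cong (λ N → 0ℤ + k * N) (pow2-suc h) ⟩
  0ℤ + k * (+ 2 * pow2 h)    ≡⟨ lemma k (pow2 h) ⟩
  + 2 * (k * pow2 h)         ∎)
  where open ≡-Reasoning
        lemma : ∀ k N → 0ℤ + k * (+ 2 * N) ≡ + 2 * (k * N)
        lemma = solve-∀

Odd-2*-−-Sign : ∀ q → Sign t → Odd (+ 2 * q - t)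
Odd-2*-−-Sign q one       = q - 1ℤ , lemma q
  where lemma : ∀ q → + 2 * q - 1ℤ ≡ + 2 * (q - 1ℤ) + 1ℤ
        lemma = solve-∀
Odd-2*-−-Sign q minus-one = q , lemma q
  where lemma : ∀ q → + 2 * q - -1ℤ ≡ + 2 * q + 1ℤ
        lemma = solve-∀

Odd-−-even : ∀ t → Odd x → Odd (x - + 2 * t)
Odd-−-even t (q , refl) = q - t , lemma q t
  where lemma : ∀ q t → + 2 * q + 1ℤ - + 2 * t ≡ + 2 * (q - t) + 1ℤ
        lemma = solve-∀

Sign-+-Sign : Sign a → Sign b → ∃ λ c → a + b ≡ + 2 * c × (c ≡ 0ℤ ⊎ SignedPow2 (suc h) c)
Sign-+-Sign one       one       = 1ℤ , refl , inj₂ (plus 0 z<s)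
Sign-+-Sign one       minus-one = 0ℤ , refl , inj₁ refl
Sign-+-Sign minus-one one       = 0ℤ , refl , inj₁ refl
Sign-+-Sign minus-one minus-one = -1ℤ , refl , inj₂ (minus 0 z<s)

extractSign : Odd x → Represents (suc h) L x →
  ∃ λ τ → ∃ λ L′ → Sign τ × length L ≡ suc (length L′) × Represents (suc h) L′ (x - τ)
extractSign {L = []} o (represents [] c) = ⊥-elim (Odd⇒≢0-mod o c)
extractSign {x} {L = t ∷ L} o r@(represents (p ∷ _) _) with parityView p
... | odd s = t , L , s , refl , Represents-∷⁻ r
... | even {t₀} _ with extractSign (Odd-−-even t₀ o) (Represents-∷⁻ r)
...   | τ , L′ , s , len , r′ =
  τ , t ∷ L′ , s , cong suc len , Represents-∷⁺ p (subst (Represents _ L′) (swap x (+ 2 * t₀) τ) r′)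
  where swap : ∀ x a b → x - a - b ≡ x - b - a
        swap = solve-∀

-- n bounds the length: pairing two terms ±1 recurses on a list two shorter.
Represents-halve : ∀ n → length L ≤ n → Represents (suc h) L (+ 2 * q) → WeightAtMost h (length L) q
Represents-halve {h = zero} {q} _ _ _ = [] , z≤n , Represents-mod1 q
Represents-halve {L = []} {suc h} _ _ (represents [] c) = [] , z≤n , represents [] (≡mod-halve {b = 0ℤ} c)
Represents-halve {L = t ∷ L} {suc h} {q} (suc n) (s≤s len) r@(represents (p ∷ _) _)
  with parityView p
... | even {t₀} p₀ =
  WeightAtMost-∷ (inj₂ p₀) (Represents-halve n len (subst (Represents _ L) (lemma q t₀) (Represents-∷⁻ r)))
  where lemma : ∀ q t → + 2 * q - + 2 * t ≡ + 2 * (q - t)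
        lemma = solve-∀
... | odd {τ₁} s₁ with extractSign (Odd-2*-−-Sign q s₁) (Represents-∷⁻ r)
...   | τ₂ , L₁ , s₂ , len₁ , r₁ with Sign-+-Sign s₁ s₂
...     | σ , τ₁+τ₂≡2σ , σ-term =
  WeightAtMost-mono (s≤s L₁≤L)
    (WeightAtMost-∷ σ-term
      (Represents-halve n (ℕₚ.≤-trans L₁≤L len) (subst (Represents _ L₁) eq r₁)))
  where L₁≤L : length L₁ ≤ length L
        L₁≤L = ℕₚ.≤-trans (ℕₚ.n≤1+n _) (ℕₚ.≤-reflexive (sym len₁))
        lemma : ∀ q a b → + 2 * q - a - b ≡ + 2 * q - (a + b)
        lemma = solve-∀
        lemma′ : ∀ q c → + 2 * q - + 2 * c ≡ + 2 * (q - c)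
        lemma′ = solve-∀
        eq : + 2 * q - τ₁ - τ₂ ≡ + 2 * (q - σ)
        eq = trans (lemma q τ₁ τ₂) (trans (cong (λ s → + 2 * q - s) τ₁+τ₂≡2σ) (lemma′ q σ))

WeightAtLeast-zero : WeightAtLeast h 0 x
WeightAtLeast-zero _ _ = z≤n

WeightAtLeast-mono : m ≤ n → WeightAtLeast h n x → WeightAtLeast h m x
WeightAtLeast-mono m≤n lb L r = ℕₚ.≤-trans m≤n (lb L r)

WeightAtLeast-double : WeightAtLeast h n q → WeightAtLeast (suc h) n (+ 2 * q)
WeightAtLeast-double lb L r with Represents-halve (length L) ℕₚ.≤-refl r
... | L′ , len , r′ = ℕₚ.≤-trans (lb L′ r′) len

WeightAtLeast-odd : Odd x → WeightAtLeast (suc h) n (x - 1ℤ) → WeightAtLeast (suc h) n (x + 1ℤ) →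
                    WeightAtLeast (suc h) (suc n) x
WeightAtLeast-odd {n = n} o lb₋ lb₊ L r with extractSign o r
... | _ , L′ , one       , len , r′ = subst (suc n ≤_) (sym len) (s≤s (lb₋ L′ r′))
... | _ , L′ , minus-one , len , r′ = subst (suc n ≤_) (sym len) (s≤s (lb₊ L′ r′))

repunit₄ : ℕ → ℕ
repunit₄ zero    = 0
repunit₄ (suc k) = 1 ℕ.+ 4 ℕ.* repunit₄ k

repunit₄-suc : ∀ k → + repunit₄ (suc k) ≡ + 2 * (+ 2 * + repunit₄ k) + 1ℤ
repunit₄-suc k = begin
  + (1 ℕ.+ 4 ℕ.* repunit₄ k)      ≡⟨ pos-+ 1 (4 ℕ.* repunit₄ k) ⟩
  1ℤ + + (4 ℕ.* repunit₄ k)       ≡⟨ cong (λ s → 1ℤ + s) (pos-* 4 (repunit₄ k)) ⟩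
  1ℤ + + 4 * + repunit₄ k         ≡⟨ lemma (+ repunit₄ k) ⟩
  + 2 * (+ 2 * + repunit₄ k) + 1ℤ ∎
  where open ≡-Reasoning
        lemma : ∀ r → 1ℤ + + 4 * r ≡ + 2 * (+ 2 * r) + 1ℤ
        lemma = solve-∀

repunit₄-weight       : ∀ h → WeightAtLeast h ⌈ h /2⌉ (+ repunit₄ ⌈ h /2⌉)
doubleRepunit₄-weight : ∀ h → WeightAtLeast h ⌊ h /2⌋ (+ 2 * + repunit₄ ⌊ h /2⌋)
oddRepunit₄-weight    : ∀ h → WeightAtLeast h ⌊ h /2⌋ (+ 2 * + repunit₄ ⌊ h /2⌋ + 1ℤ)

repunit₄-weight zero    = WeightAtLeast-zero
repunit₄-weight (suc h) = subst (WeightAtLeast (suc h) _) (sym (repunit₄-suc ⌊ h /2⌋))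
  (WeightAtLeast-odd (+ 2 * R , refl)
    (subst (WeightAtLeast (suc h) _) (lemma₋ R) (WeightAtLeast-double (doubleRepunit₄-weight h)))
    (subst (WeightAtLeast (suc h) _) (lemma₊ R) (WeightAtLeast-double (oddRepunit₄-weight h))))
  where
    R = + repunit₄ ⌊ h /2⌋
    lemma₋ : ∀ r → + 2 * (+ 2 * r) ≡ + 2 * (+ 2 * r) + 1ℤ - 1ℤ
    lemma₋ = solve-∀
    lemma₊ : ∀ r → + 2 * (+ 2 * r + 1ℤ) ≡ + 2 * (+ 2 * r) + 1ℤ + 1ℤ
    lemma₊ = solve-∀

doubleRepunit₄-weight zero    = WeightAtLeast-zero
doubleRepunit₄-weight (suc h) = WeightAtLeast-double (repunit₄-weight h)

oddRepunit₄-weight zero          = WeightAtLeast-zero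
oddRepunit₄-weight (suc zero)    = WeightAtLeast-zero
oddRepunit₄-weight (suc (suc h)) = WeightAtLeast-odd (R′ , refl)
  (subst (WeightAtLeast (suc (suc h)) _) (lemma₋ R′)
    (WeightAtLeast-double (WeightAtLeast-mono (ℕₚ.n≤1+n _) (repunit₄-weight (suc h)))))
  (subst (WeightAtLeast (suc (suc h)) _) eq₊
    (WeightAtLeast-double (WeightAtLeast-double (oddRepunit₄-weight h))))
  where
    R = + repunit₄ ⌊ h /2⌋
    R′ = + repunit₄ (suc ⌊ h /2⌋)
    lemma₋ : ∀ r → + 2 * r ≡ + 2 * r + 1ℤ - 1ℤ
    lemma₋ = solve-∀
    lemma₊ : ∀ r → + 2 * (+ 2 * (+ 2 * r + 1ℤ)) ≡ + 2 * (+ 2 * (+ 2 * r) + 1ℤ) + 1ℤ + 1ℤ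
    lemma₊ = solve-∀
    eq₊ : + 2 * (+ 2 * (+ 2 * R + 1ℤ)) ≡ + 2 * R′ + 1ℤ + 1ℤ
    eq₊ = trans (lemma₊ R) (cong (λ s → + 2 * s + 1ℤ + 1ℤ) (sym (repunit₄-suc ⌊ h /2⌋)))

binaryDigit : ∀ h a → ∃ λ d → ∃ λ q → (d ≡ 0ℤ ⊎ SignedPow2 (suc h) d) × a - d ≡ + 2 * q
binaryDigit h a with a %ℕ 2 | n%ℕd<d a 2 | a≡a%ℕn+[a/ℕn]*n a 2
... | 0 | _ | e = 0ℤ , a /ℕ 2 , inj₁ refl , trans (cong (_- 0ℤ) e) (lemma (a /ℕ 2))
  where lemma : ∀ q → + 0 + q * + 2 - 0ℤ ≡ + 2 * q
        lemma = solve-∀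
... | 1 | _ | e = 1ℤ , a /ℕ 2 , inj₂ (plus 0 z<s) , trans (cong (_- 1ℤ) e) (lemma (a /ℕ 2))
  where lemma : ∀ q → + 1 + q * + 2 - 1ℤ ≡ + 2 * q
        lemma = solve-∀
... | suc (suc _) | s≤s (s≤s ()) | _

quaternaryDigit : ∀ h a → ∃ λ d → ∃ λ q → (d ≡ 0ℤ ⊎ SignedPow2 (suc (suc h)) d) × a - d ≡ + 2 * (+ 2 * q)
quaternaryDigit h a with a %ℕ 4 | n%ℕd<d a 4 | a≡a%ℕn+[a/ℕn]*n a 4
... | 0 | _ | e = 0ℤ , a /ℕ 4 , inj₁ refl , trans (cong (_- 0ℤ) e) (lemma (a /ℕ 4))
  where lemma : ∀ q → + 0 + q * + 4 - 0ℤ ≡ + 2 * (+ 2 * q)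
        lemma = solve-∀
... | 1 | _ | e = 1ℤ , a /ℕ 4 , inj₂ (plus 0 z<s) , trans (cong (_- 1ℤ) e) (lemma (a /ℕ 4))
  where lemma : ∀ q → + 1 + q * + 4 - 1ℤ ≡ + 2 * (+ 2 * q)
        lemma = solve-∀
... | 2 | _ | e = + 2 , a /ℕ 4 , inj₂ (plus 1 (s≤s z<s)) , trans (cong (_- + 2) e) (lemma (a /ℕ 4))
  where lemma : ∀ q → + 2 + q * + 4 - + 2 ≡ + 2 * (+ 2 * q)
        lemma = solve-∀
... | 3 | _ | e = -1ℤ , a /ℕ 4 + 1ℤ , inj₂ (minus 0 z<s) , trans (cong (_- -1ℤ) e) (lemma (a /ℕ 4))
  where lemma : ∀ q → + 3 + q * + 4 - -1ℤ ≡ + 2 * (+ 2 * (q + 1ℤ))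
        lemma = solve-∀
... | suc (suc (suc (suc _))) | s≤s (s≤s (s≤s (s≤s ()))) | _

WeightAtMost-⌈h/2⌉ : ∀ h a → WeightAtMost h ⌈ h /2⌉ a
WeightAtMost-⌈h/2⌉ zero a = [] , z≤n , Represents-mod1 a
WeightAtMost-⌈h/2⌉ (suc zero) a with binaryDigit 0 a
... | d , q , digit , eq =
  WeightAtMost-∷ digit (subst (WeightAtMost 1 0) (sym eq)
    (WeightAtMost-double (WeightAtMost-⌈h/2⌉ 0 q)))
WeightAtMost-⌈h/2⌉ (suc (suc h)) a with quaternaryDigit h a
... | d , q , digit , eq =
  WeightAtMost-∷ digit (subst (WeightAtMost (suc (suc h)) ⌈ h /2⌉) (sym eq)
    (WeightAtMost-double (WeightAtMost-double (WeightAtMost-⌈h/2⌉ h q))))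

residue : ∀ h a → ∃ λ (z : Fin (2 ^ h)) → a ≡ + toℕ z [mod2^ h ]
residue h a = fromℕ< r<2^h , multiple (a /ℕ 2 ^ h) (trans (a≡a%ℕn+[a/ℕn]*n a (2 ^ h))
  (cong (λ r → + r + (a /ℕ 2 ^ h) * pow2 h) (sym (Finₚ.toℕ-fromℕ< r<2^h))))
  where
    instance
      _ : NonZero (2 ^ h)
      _ = ℕₚ.m^n≢0 2 h
    r<2^h : a %ℕ 2 ^ h < 2 ^ h
    r<2^h = n%ℕd<d a (2 ^ h)

module _ {h : ℕ} {x z : Fin (2 ^ h)} where

  SignedPow2-step⇒MCAdj : SignedPow2 h t → + toℕ z - + toℕ x ≡ t [mod2^ h ] → MCAdj 2 h x z
  SignedPow2-step⇒MCAdj {t} p c = x≢z , power p c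
    where
      x≢z : x ≢ z
      x≢z refl = SignedPow2≢0-mod p (≡mod-sym (subst (_≡ t [mod2^ h ]) (ℤₚ.+-inverseʳ (+ toℕ x)) c))
      power : SignedPow2 h t → + toℕ z - + toℕ x ≡ t [mod2^ h ] → ∃ λ i → i < h ×
        (toℕ x ≡ toℕ z ℕ.+ 2 ^ i [mod 2 ^ h ] ⊎ toℕ z ≡ toℕ x ℕ.+ 2 ^ i [mod 2 ^ h ])
      power (plus i i<h)  c = i , i<h , inj₂ (diff≡pow2⇒≡mod {n = toℕ x} {i} c)
      power (minus i i<h) c = i , i<h , inj₁ (diff≡pow2⇒≡mod {n = toℕ z} {i}
        (subst (λ s → + toℕ x - + toℕ z ≡ s [mod2^ h ]) (ℤₚ.neg-involutive (pow2 i))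
          (≡mod-diff-swap {a = + toℕ z} {+ toℕ x} c)))

  MCAdj⇒SignedPow2-step : MCAdj 2 h x z → ∃ λ t → SignedPow2 h t × + toℕ z - + toℕ x ≡ t [mod2^ h ]
  MCAdj⇒SignedPow2-step (_ , i , i<h , inj₂ c) = pow2 i , plus i i<h , ≡mod⇒diff≡pow2 {toℕ z} {toℕ x} {i} c
  MCAdj⇒SignedPow2-step (_ , i , i<h , inj₁ c) =
    - pow2 i , minus i i<h ,
    ≡mod-diff-swap {a = + toℕ x} {+ toℕ z} (≡mod⇒diff≡pow2 {toℕ x} {toℕ z} {i} c)

neighbour : (x : Fin (2 ^ h)) → SignedPow2 h t →
  ∃ λ z → MCAdj 2 h x z × + toℕ z - + toℕ x ≡ t [mod2^ h ]
neighbour {h} {t} x p with residue h (+ toℕ x + t)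
... | z , c = z , SignedPow2-step⇒MCAdj p z-x≡t , z-x≡t
  where z-x≡t : + toℕ z - + toℕ x ≡ t [mod2^ h ]
        z-x≡t = ≡mod-sub {b = + toℕ x} (≡mod-sym c)

Walk⇒Represents : {x y : Fin (2 ^ h)} → Walk 2 h n x y →
  ∃ λ L → length L ≡ n × Represents h L (+ toℕ y - + toℕ x)
Walk⇒Represents {h} {x = x} here =
  [] , refl , represents [] (subst (_≡ 0ℤ [mod2^ h ]) (sym (ℤₚ.+-inverseʳ (+ toℕ x))) ≡mod-refl)
Walk⇒Represents {h} {x = x} {y} (step {y = z} adj w)
  with MCAdj⇒SignedPow2-step adj | Walk⇒Represents w
... | t , p , c | L , refl , represents ps c′ =
  t ∷ L , refl , represents (p ∷ ps)
    (subst (_≡ t + sumℤ L [mod2^ h ]) (lemma (+ toℕ x) (+ toℕ y) (+ toℕ z)) (≡mod-+ c c′))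
  where lemma : ∀ x y z → (z - x) + (y - z) ≡ y - x
        lemma = solve-∀

Represents⇒Walk : ∀ L {x y : Fin (2 ^ h)} → Represents h L (+ toℕ y - + toℕ x) → Walk 2 h (length L) x y
Represents⇒Walk {h} [] {x} {y} (represents [] c) = subst (Walk 2 h 0 x) x≡y here
  where x≡y : x ≡ y
        x≡y = toℕ-≡mod2^-injective
          (≡mod-sym (subst (+ toℕ y ≡_[mod2^ h ]) (ℤₚ.+-identityʳ (+ toℕ x)) (≡mod-add {b = + toℕ x} c)))
Represents⇒Walk {h} (t ∷ L) {x} {y} (represents (p ∷ ps) c) with neighbour x p
... | z , adj , c′ = step adj (Represents⇒Walk L (represents ps
      (subst₂ (_≡_[mod2^ h ]) (lemma (+ toℕ x) (+ toℕ y) (+ toℕ z)) (lemma′ t (sumℤ L))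
              (≡mod-+ c (≡mod-neg c′)))))
  where lemma : ∀ x y z → (y - x) + - (z - x) ≡ y - z
        lemma = solve-∀
        lemma′ : ∀ t s → (t + s) + - t ≡ s
        lemma′ = solve-∀

repunit₄-<-2^ : ∀ h → repunit₄ ⌈ h /2⌉ < 2 ^ h
repunit₄-<-2^ zero          = s≤s z≤n
repunit₄-<-2^ (suc zero)    = s≤s (s≤s z≤n)
repunit₄-<-2^ (suc (suc h)) = begin-strict
  1 ℕ.+ 4 ℕ.* r   <⟨ ℕₚ.+-monoˡ-≤ (4 ℕ.* r) {2} {4} (s≤s (s≤s z≤n)) ⟩
  4 ℕ.+ 4 ℕ.* r   ≡⟨ ℕₚ.*-suc 4 r ⟨
  4 ℕ.* suc r     ≤⟨ ℕₚ.*-monoʳ-≤ 4 (repunit₄-<-2^ h) ⟩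
  4 ℕ.* 2 ^ h     ≡⟨ ℕₚ.*-assoc 2 2 (2 ^ h) ⟩
  2 ^ suc (suc h) ∎
  where open ℕₚ.≤-Reasoning
        r = repunit₄ ⌈ h /2⌉

diameter : ∀ h → IsDiam 2 h ⌈ h /2⌉
diameter h = upper , x₀ , y₀ , lower
  where
    x₀ y₀ : Fin (2 ^ h)
    x₀ = fromℕ< (ℕₚ.m^n>0 2 h)
    y₀ = fromℕ< (repunit₄-<-2^ h)
    upper : (x y : Fin (2 ^ h)) → ∃ λ n → n ≤ ⌈ h /2⌉ × Walk 2 h n x y
    upper x y with WeightAtMost-⌈h/2⌉ h (+ toℕ y - + toℕ x)
    ... | L , len , r = length L , len , Represents⇒Walk L r
    y₀-x₀ : + toℕ y₀ - + toℕ x₀ ≡ + repunit₄ ⌈ h /2⌉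
    y₀-x₀ = trans (cong₂ (λ a b → + a - + b) (Finₚ.toℕ-fromℕ< (repunit₄-<-2^ h))
                                             (Finₚ.toℕ-fromℕ< (ℕₚ.m^n>0 2 h)))
                  (ℤₚ.+-identityʳ _)
    lower : ∀ n → Walk 2 h n x₀ y₀ → ⌈ h /2⌉ ≤ n
    lower n w with Walk⇒Represents w
    ... | L , refl , r = repunit₄-weight h L (subst (Represents h L) y₀-x₀ r)

⌈n/2⌉≡⌊n/2⌋ : ∀ n → n % 2 ≡ 0 → ⌈ n /2⌉ ≡ ⌊ n /2⌋
⌈n/2⌉≡⌊n/2⌋ zero          _ = refl
⌈n/2⌉≡⌊n/2⌋ (suc (suc n)) e = cong suc (⌈n/2⌉≡⌊n/2⌋ n e)

⌈n/2⌉≡1+⌊n/2⌋ : ∀ n → n % 2 ≡ 1 → ⌈ n /2⌉ ≡ suc ⌊ n /2⌋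
⌈n/2⌉≡1+⌊n/2⌋ (suc zero)    _ = refl
⌈n/2⌉≡1+⌊n/2⌋ (suc (suc n)) e = cong suc (⌈n/2⌉≡1+⌊n/2⌋ n e)

theorem3p8 : (h : ℕ) → 2 ≤ h →
    ∃ λ d → IsDiam 2 (h ∸ 1) d ×
      ((h % 2 ≡ 0 → IsDiam 2 h d) × (h % 2 ≡ 1 → IsDiam 2 h (suc d)))
theorem3p8 (suc (suc h)) (s≤s (s≤s _)) = ⌈ suc h /2⌉ , diameter (suc h) , when-even , when-odd
  where
    when-even : h % 2 ≡ 0 → IsDiam 2 (suc (suc h)) ⌈ suc h /2⌉
    when-even e = subst (IsDiam 2 (suc (suc h))) (cong suc (⌈n/2⌉≡⌊n/2⌋ h e)) (diameter (suc (suc h)))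
    when-odd : h % 2 ≡ 1 → IsDiam 2 (suc (suc h)) (suc ⌈ suc h /2⌉)
    when-odd o = subst (IsDiam 2 (suc (suc h))) (cong suc (⌈n/2⌉≡1+⌊n/2⌋ h o)) (diameter (suc (suc h)))
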